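{- Let $k,h,s$ be integers with $k\geq 1$, $h\geq 0$, $s\geq 1$. Then \[\sum_{i\geq 0}(-1)^iq^{k(i^2-i)}{{s}\brack {i}}_{2k}{{h-2i+s-1}\brack {s-1}}_{k}=q^{k(h^2-h)/2}{{s}\brack {h}}_{k}.\]
   Context: $(x;q)_0=1$, $(x;q)_n=(1-x)\cdots(1-xq^{n-1})$. For a positive integer $k$ and integers $A,B$, ${A\brack B}_k=\frac{(q^k;q^k)_A}{(q^k;q^k)_B(q^k;q^k)_{A-B}}$ if $A\geq B\geq 0$, and $0$ otherwise. -}

module Defs where

open import Data.Nat as ℕ using (ℕ; zero; suc)
open import Data.Integer as ℤ using (ℤ; +_)
open import Data.Rational using (ℚ; 0ℚ; 1ℚ; _*_; _+_; _-_; -_; 1/_; ≢-nonZero)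
open import Data.Rational.Properties using (_≟_)
open import Data.List using (List; map; upTo; foldr)
open import Relation.Nullary using (yes; no)
open import Data.Bool using (if_then_else_; _∧_)
open import Relation.Nullary.Decidable using (⌊_⌋)
open import Data.Integer.Properties as ℤP using ()

_^_ : ℚ → ℕ → ℚ
x ^ zero = 1ℚ
x ^ suc n = x * (x ^ n)

-- total inverse: inv p = 1/p when p ≠ 0, and 0 otherwise (only used
-- where the denominator is nonzero)
inv : ℚ → ℚ
inv p with p ≟ 0ℚ
... | yes _ = 0ℚ
... | no p≢0 = 1/_ p {{≢-nonZero p≢0}}

poch : ℚ → ℚ → ℕ → ℚ
poch x q zero = 1ℚ
poch x q (suc n) = poch x q n * (1ℚ - x * (q ^ n))

-- Gaussian binomial [A brack B]_k evaluated at q: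
-- (q^k;q^k)_A / ((q^k;q^k)_B (q^k;q^k)_{A-B}) if A ≥ B ≥ 0, and 0 otherwise
gbin : ℕ → ℚ → ℤ → ℤ → ℚ
gbin k q A B =
  if ⌊ + 0 ℤP.≤? B ⌋ ∧ ⌊ B ℤP.≤? A ⌋
  then poch (q ^ k) (q ^ k) a * inv (poch (q ^ k) (q ^ k) b * poch (q ^ k) (q ^ k) (a ℕ.∸ b))
  else 0ℚ
  where
  a = ℤ.∣ A ∣
  b = ℤ.∣ B ∣

sumTo : ℕ → (ℕ → ℚ) → ℚ
sumTo n f = foldr _+_ 0ℚ (map f (upTo n))

{-# OPTIONS --safe #-}

-- Write p = q ^ k and model formal power series in x by their coefficient sequences.
-- By Cauchy's q-binomial theorem and its negative version,
--   ∏_{j<s} (1 - p^{2j} x²) = Σ_i (-1)^i p^{i²-i} [s, i]_{p²} x^{2i},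
--   1 / ∏_{j<s} (1 - p^j x) = Σ_n [n+s-1, s-1]_p x^n,
--   ∏_{j<s} (1 + p^j x)     = Σ_h p^{h(h-1)/2} [s, h]_p x^h,
-- so the sum is the coefficient of x^h in the product of the first two series, which
-- equals the third because 1 - p^{2j} x² = (1 - p^j x)(1 + p^j x).  The hypothesis
-- q ≠ ±1 makes p and p² non-roots of unity, so no q-factorial in these Gaussian
-- binomials vanishes.

module Submission where

open import Defs
open import Data.Nat as ℕ using (ℕ; _≥_; _/_)
open import Data.Integer as ℤ using (+_)
open import Data.Rational using (ℚ; 1ℚ; -_; _*_)
open import Relation.Binary.PropositionalEquality using (_≡_; _≢_)

open import Algebra.Bundles using (CommutativeRing)
open import Data.Bool using (if_then_else_)
import Data.Integer.Properties as ℤₚ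
import Data.Integer.Tactic.RingSolver as ℤ-Solver
open import Data.List using (foldr; upTo)
open import Data.List.Properties using (map-applyUpTo; map-cong)
open import Data.Nat using (zero; suc; _∸_; _≤?_; compare; less; equal; greater)
open import Data.Nat.Combinatorics using (_C_; nC1≡n; nCk+nC[k+1]≡[n+1]C[k+1])
open import Data.Nat.DivMod using (m*n/n≡m)
import Data.Nat.Properties as ℕₚ
import Data.Nat.Tactic.RingSolver as ℕ-Solver
open import Data.Rational using (0ℚ; _+_; _-_; ∣_∣; _≤_; nonNegative; ≢-nonZero)
open import Data.Rational.Properties
  using ( _≟_; +-*-commutativeRing; +-0-group; heytingCommutativeRing
        ; +-assoc; +-identityʳ; *-assoc; *-comm; *-identityˡ; *-identityʳ; *-zeroˡ; *-zeroʳ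
        ; *-inverseʳ; 1≢0; neg-injective; ∣p*q∣≡∣p∣*∣q∣; ∣p∣≡p∨∣p∣≡-p; 0≤∣p∣
        ; ≤-refl; ≤-trans; <⇒≤; <-irrefl; <-cmp; nonNegative⁻¹; *-monoˡ-≤-nonNeg; module ≤-Reasoning )
open import Algebra.Apartness.Properties.HeytingCommutativeRing heytingCommutativeRing using (x#0y#0→xy#0)
open import Algebra.Properties.Group +-0-group using (x∙y⁻¹≈ε⇒x≈y)
import Algebra.Properties.CommutativeSemiring.Exp (CommutativeRing.commutativeSemiring +-*-commutativeRing) as Exp
open import Data.Empty using (⊥-elim)
open import Data.Sum as Sum using (_⊎_; [_,_]′)
open import Function using (_∘_; id)
open import Level using (0ℓ)
open import Relation.Binary.Definitions using (tri<; tri≈; tri>)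
open import Relation.Binary.PropositionalEquality
  using (refl; sym; trans; cong; cong₂; subst; _≗_; module ≡-Reasoning)
open import Relation.Nullary using (¬_; yes; no; contradiction)
open import Relation.Nullary.Decidable using (⌊_⌋; dec⇒maybe)
import Tactic.RingSolver as Solver
open import Tactic.RingSolver.Core.AlmostCommutativeRing using (AlmostCommutativeRing; fromCommutativeRing)

ℚ-ring : AlmostCommutativeRing 0ℓ 0ℓ
ℚ-ring = fromCommutativeRing +-*-commutativeRing (λ x → dec⇒maybe (0ℚ ≟ x))

^≡Exp^ : ∀ x n → x ^ n ≡ x Exp.^ n
^≡Exp^ x zero    = refl
^≡Exp^ x (suc n) = cong (x *_) (^≡Exp^ x n)

^-homo-* : ∀ x m n → x ^ (m ℕ.+ n) ≡ x ^ m * x ^ n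
^-homo-* x m n rewrite ^≡Exp^ x (m ℕ.+ n) | ^≡Exp^ x m | ^≡Exp^ x n = Exp.^-homo-* x m n

^-distrib-* : ∀ x y n → (x * y) ^ n ≡ x ^ n * y ^ n
^-distrib-* x y n rewrite ^≡Exp^ (x * y) n | ^≡Exp^ x n | ^≡Exp^ y n = Exp.^-distrib-* x y n

^-assocʳ : ∀ x m n → (x ^ m) ^ n ≡ x ^ (m ℕ.* n)
^-assocʳ x m n rewrite ^≡Exp^ x m | ^≡Exp^ (x Exp.^ m) n | ^≡Exp^ x (m ℕ.* n) = Exp.^-assocʳ x m n

1^n≡1 : ∀ n → 1ℚ ^ n ≡ 1ℚ
1^n≡1 zero    = refl
1^n≡1 (suc n) = trans (*-identityˡ (1ℚ ^ n)) (1^n≡1 n)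

∣-∣-homo-^ : ∀ x n → ∣ x ^ n ∣ ≡ ∣ x ∣ ^ n
∣-∣-homo-^ x zero    = refl
∣-∣-homo-^ x (suc n) = trans (∣p*q∣≡∣p∣*∣q∣ x (x ^ n)) (cong (∣ x ∣ *_) (∣-∣-homo-^ x n))

^-≤-1 : ∀ {r} → 0ℚ ≤ r → r ≤ 1ℚ → ∀ n → r ^ n ≤ 1ℚ
^-≤-1 r≥0 r≤1 zero = ≤-refl
^-≤-1 {r} r≥0 r≤1 (suc n) = begin
  r * r ^ n ≤⟨ *-monoˡ-≤-nonNeg r {{nonNegative r≥0}} (^-≤-1 r≥0 r≤1 n) ⟩
  r * 1ℚ    ≡⟨ *-identityʳ r ⟩
  r         ≤⟨ r≤1 ⟩
  1ℚ        ∎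
  where open ≤-Reasoning

1-≤-^ : ∀ {r} → 1ℚ ≤ r → ∀ n → 1ℚ ≤ r ^ n
1-≤-^ r≥1 zero = ≤-refl
1-≤-^ {r} r≥1 (suc n) = begin
  1ℚ        ≤⟨ r≥1 ⟩
  r         ≡⟨ *-identityʳ r ⟨
  r * 1ℚ    ≤⟨ *-monoˡ-≤-nonNeg r {{nonNegative (≤-trans (nonNegative⁻¹ 1ℚ) r≥1)}} (1-≤-^ r≥1 n) ⟩
  r * r ^ n ∎
  where open ≤-Reasoning

nonNeg-^-suc≡1⇒≡1 : ∀ {r} m → 0ℚ ≤ r → r ^ suc m ≡ 1ℚ → r ≡ 1ℚ
nonNeg-^-suc≡1⇒≡1 {r} m r≥0 rᵐ⁺¹≡1 with <-cmp r 1ℚ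
... | tri≈ _ r≡1 _ = r≡1
... | tri< r<1 _ _ = ⊥-elim (<-irrefl rᵐ⁺¹≡1 (begin-strict
  r * r ^ m ≤⟨ *-monoˡ-≤-nonNeg r {{nonNegative r≥0}} (^-≤-1 r≥0 (<⇒≤ r<1) m) ⟩
  r * 1ℚ    ≡⟨ *-identityʳ r ⟩
  r         <⟨ r<1 ⟩
  1ℚ        ∎))
  where open ≤-Reasoning
... | tri> _ _ r>1 = ⊥-elim (<-irrefl (sym rᵐ⁺¹≡1) (begin-strict
  1ℚ        <⟨ r>1 ⟩
  r         ≡⟨ *-identityʳ r ⟨
  r * 1ℚ    ≤⟨ *-monoˡ-≤-nonNeg r {{nonNegative r≥0}} (1-≤-^ (<⇒≤ r>1) m) ⟩
  r * r ^ m ∎))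
  where open ≤-Reasoning

^-suc≡1⇒≡±1 : ∀ q m → q ^ suc m ≡ 1ℚ → q ≡ 1ℚ ⊎ q ≡ - 1ℚ
^-suc≡1⇒≡±1 q m qᵐ⁺¹≡1 =
  Sum.map (λ ∣q∣≡q → trans (sym ∣q∣≡q) ∣q∣≡1)
          (λ ∣q∣≡-q → neg-injective (trans (sym ∣q∣≡-q) ∣q∣≡1))
          (∣p∣≡p∨∣p∣≡-p q)
  where
  ∣q∣≡1 : ∣ q ∣ ≡ 1ℚ
  ∣q∣≡1 = nonNeg-^-suc≡1⇒≡1 m (0≤∣p∣ q) (trans (sym (∣-∣-homo-^ q (suc m))) (cong ∣_∣ qᵐ⁺¹≡1))

NotRootOfUnity : ℚ → Set
NotRootOfUnity r = ∀ n → r ^ suc n ≢ 1ℚ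

q^k≉root : ∀ {q} → q ≢ 1ℚ → q ≢ - 1ℚ → ∀ k .{{_ : ℕ.NonZero k}} → NotRootOfUnity (q ^ k)
q^k≉root {q} q≢1 q≢-1 (suc k) n qᵏ⁽ⁿ⁺¹⁾≡1 =
  [ q≢1 , q≢-1 ]′ (^-suc≡1⇒≡±1 q (n ℕ.+ k ℕ.* suc n)
                                  (trans (sym (^-assocʳ q (suc k) (suc n))) qᵏ⁽ⁿ⁺¹⁾≡1))

-- Formal power series

Series : Set
Series = ℕ → ℚ

𝟙 : Series
𝟙 zero    = 1ℚ
𝟙 (suc _) = 0ℚ

infixl 7 _⊛_
_⊛_ : Series → Series → Series
(f ⊛ g) zero    = f 0 * g 0
(f ⊛ g) (suc n) = f 0 * g (suc n) + (f ∘ suc ⊛ g) n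

[1+_x]·_ : ℚ → Series → Series
([1+ a x]· f) zero    = f 0
([1+ a x]· f) (suc n) = f (suc n) + a * f n

_/[1-_x] : Series → ℚ → Series
(f /[1- a x]) zero    = f 0
(f /[1- a x]) (suc n) = f (suc n) + a * (f /[1- a x]) n

_[x²] : Series → Series
(f [x²]) zero          = f 0
(f [x²]) (suc zero)    = 0ℚ
(f [x²]) (suc (suc n)) = ((f ∘ suc) [x²]) n

∏[1+_x]_ : (ℕ → ℚ) → ℕ → Series
∏[1+ a x] zero  = 𝟙
∏[1+ a x] suc s = [1+ a s x]· (∏[1+ a x] s)

∏⁻¹[1-_x]_ : (ℕ → ℚ) → ℕ → Series
∏⁻¹[1- a x] zero  = 𝟙
∏⁻¹[1- a x] suc s = (∏⁻¹[1- a x] s) /[1- a s x]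

⊛-cong : ∀ {f f′ g g′} → f ≗ f′ → g ≗ g′ → f ⊛ g ≗ f′ ⊛ g′
⊛-cong f≗f′ g≗g′ zero    = cong₂ _*_ (f≗f′ 0) (g≗g′ 0)
⊛-cong f≗f′ g≗g′ (suc n) =
  cong₂ _+_ (cong₂ _*_ (f≗f′ 0) (g≗g′ (suc n))) (⊛-cong (f≗f′ ∘ suc) g≗g′ n)

[1+x]·-cong : ∀ a {f g} → f ≗ g → [1+ a x]· f ≗ [1+ a x]· g
[1+x]·-cong a f≗g zero    = f≗g 0
[1+x]·-cong a f≗g (suc n) = cong₂ (λ u v → u + a * v) (f≗g (suc n)) (f≗g n)

∏-cong : ∀ {a b} → a ≗ b → ∀ s → ∏[1+ a x] s ≗ ∏[1+ b x] s
∏-cong a≗b zero    n = refl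
∏-cong {a} {b} a≗b (suc s) n =
  trans ([1+x]·-cong (a s) (∏-cong a≗b s) n) (cong (λ c → ([1+ c x]· ∏[1+ b x] s) n) (a≗b s))

⊛-zeroˡ : ∀ {f} g → (∀ n → f n ≡ 0ℚ) → ∀ n → (f ⊛ g) n ≡ 0ℚ
⊛-zeroˡ g f≡0 zero    = trans (cong (_* g 0) (f≡0 0)) (*-zeroˡ (g 0))
⊛-zeroˡ g f≡0 (suc n) =
  trans (cong₂ (λ u v → u * g (suc n) + v) (f≡0 0) (⊛-zeroˡ g (f≡0 ∘ suc) n)) (0*x+0≡0 (g (suc n)))
  where
  0*x+0≡0 : ∀ x → 0ℚ * x + 0ℚ ≡ 0ℚ
  0*x+0≡0 = Solver.solve-∀ ℚ-ring

⊛-linearˡ : ∀ a f g h n → ((λ m → f m + a * g m) ⊛ h) n ≡ (f ⊛ h) n + a * (g ⊛ h) n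
⊛-linearˡ a f g h zero    = distrib (f 0) (g 0) (h 0) a
  where
  distrib : ∀ f g h a → (f + a * g) * h ≡ f * h + a * (g * h)
  distrib = Solver.solve-∀ ℚ-ring
⊛-linearˡ a f g h (suc n) = begin
  (f 0 + a * g 0) * h (suc n) + ((λ m → f (suc m) + a * g (suc m)) ⊛ h) n
    ≡⟨ cong (_+_ ((f 0 + a * g 0) * h (suc n))) (⊛-linearˡ a (f ∘ suc) (g ∘ suc) h n) ⟩
  (f 0 + a * g 0) * h (suc n) + ((f ∘ suc ⊛ h) n + a * (g ∘ suc ⊛ h) n)
    ≡⟨ distrib (f 0) (g 0) (h (suc n)) a ((f ∘ suc ⊛ h) n) ((g ∘ suc ⊛ h) n) ⟩
  (f 0 * h (suc n) + (f ∘ suc ⊛ h) n) + a * (g 0 * h (suc n) + (g ∘ suc ⊛ h) n)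
    ∎
  where
  open ≡-Reasoning
  distrib : ∀ f g h a X Y → (f + a * g) * h + (X + a * Y) ≡ (f * h + X) + a * (g * h + Y)
  distrib = Solver.solve-∀ ℚ-ring

[1+x]·-⊛ : ∀ a f g → ([1+ a x]· f) ⊛ g ≗ [1+ a x]· (f ⊛ g)
[1+x]·-⊛ a f g zero    = refl
[1+x]·-⊛ a f g (suc n) = begin
  f 0 * g (suc n) + ((λ m → f (suc m) + a * f m) ⊛ g) n
    ≡⟨ cong (_+_ (f 0 * g (suc n))) (⊛-linearˡ a (f ∘ suc) f g n) ⟩
  f 0 * g (suc n) + ((f ∘ suc ⊛ g) n + a * (f ⊛ g) n)
    ≡⟨ +-assoc (f 0 * g (suc n)) ((f ∘ suc ⊛ g) n) (a * (f ⊛ g) n) ⟨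
  (f 0 * g (suc n) + (f ∘ suc ⊛ g) n) + a * (f ⊛ g) n
    ∎
  where open ≡-Reasoning

⊛-[1+x]· : ∀ a f g → f ⊛ ([1+ a x]· g) ≗ [1+ a x]· (f ⊛ g)
⊛-[1+x]· a f g zero          = refl
⊛-[1+x]· a f g (suc zero)    = distrib a (f 0) (g 0) (g 1) (f 1)
  where
  distrib : ∀ a f₀ g₀ g₁ f₁ →
            f₀ * (g₁ + a * g₀) + f₁ * g₀ ≡ (f₀ * g₁ + f₁ * g₀) + a * (f₀ * g₀)
  distrib = Solver.solve-∀ ℚ-ring
⊛-[1+x]· a f g (suc (suc n)) = begin
  f 0 * (g (2 ℕ.+ n) + a * g (suc n)) + (f ∘ suc ⊛ [1+ a x]· g) (suc n)
    ≡⟨ cong (_+_ (f 0 * (g (2 ℕ.+ n) + a * g (suc n)))) (⊛-[1+x]· a (f ∘ suc) g (suc n)) ⟩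
  f 0 * (g (2 ℕ.+ n) + a * g (suc n)) + ((f ∘ suc ⊛ g) (suc n) + a * (f ∘ suc ⊛ g) n)
    ≡⟨ distrib a (f 0) (g (2 ℕ.+ n)) (g (suc n)) ((f ∘ suc ⊛ g) (suc n)) ((f ∘ suc ⊛ g) n) ⟩
  (f 0 * g (2 ℕ.+ n) + (f ∘ suc ⊛ g) (suc n)) + a * (f 0 * g (suc n) + (f ∘ suc ⊛ g) n)
    ∎
  where
  open ≡-Reasoning
  distrib : ∀ a f₀ g₂ g₁ X Y →
            f₀ * (g₂ + a * g₁) + (X + a * Y) ≡ (f₀ * g₂ + X) + a * (f₀ * g₁ + Y)
  distrib = Solver.solve-∀ ℚ-ring

[1-x]·-/[1-x] : ∀ a f → [1+ - a x]· (f /[1- a x]) ≗ f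
[1-x]·-/[1-x] a f zero    = refl
[1-x]·-/[1-x] a f (suc n) = cancel (f (suc n)) a ((f /[1- a x]) n)
  where
  cancel : ∀ x a y → (x + a * y) + - a * y ≡ x
  cancel = Solver.solve-∀ ℚ-ring

[x²]-zero : ∀ {f} → (∀ n → f n ≡ 0ℚ) → ∀ n → (f [x²]) n ≡ 0ℚ
[x²]-zero f≡0 zero          = f≡0 0
[x²]-zero f≡0 (suc zero)    = refl
[x²]-zero f≡0 (suc (suc n)) = [x²]-zero (f≡0 ∘ suc) n

[x²]-linear : ∀ b f g n → ((λ m → f m + b * g m) [x²]) n ≡ (f [x²]) n + b * (g [x²]) n
[x²]-linear b f g zero          = refl
[x²]-linear b f g (suc zero)    = sym (0+b*0≡0 b)
  where
  0+b*0≡0 : ∀ b → 0ℚ + b * 0ℚ ≡ 0ℚ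
  0+b*0≡0 = Solver.solve-∀ ℚ-ring
[x²]-linear b f g (suc (suc n)) = [x²]-linear b (f ∘ suc) (g ∘ suc) n

[x²]-[1+x]· : ∀ a f → ([1+ - (a * a) x]· f) [x²] ≗ [1+ a x]· ([1+ - a x]· (f [x²]))
[x²]-[1+x]· a f zero          = refl
[x²]-[1+x]· a f (suc zero)    = sym (cancel a (f 0))
  where
  cancel : ∀ a f₀ → (0ℚ + - a * f₀) + a * f₀ ≡ 0ℚ
  cancel = Solver.solve-∀ ℚ-ring
[x²]-[1+x]· a f (suc (suc n)) = begin
  ((λ m → f (suc m) + - (a * a) * f m) [x²]) n
    ≡⟨ [x²]-linear (- (a * a)) (f ∘ suc) f n ⟩
  F₂ + - (a * a) * F₀
    ≡⟨ expand F₂ F₁ F₀ a ⟩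
  (F₂ + - a * F₁) + a * (F₁ + - a * F₀)
    ∎
  where
  open ≡-Reasoning
  F₂ = ((f ∘ suc) [x²]) n
  F₁ = (f [x²]) (suc n)
  F₀ = (f [x²]) n
  expand : ∀ F₂ F₁ F₀ a → F₂ + - (a * a) * F₀ ≡ (F₂ + - a * F₁) + a * (F₁ + - a * F₀)
  expand = Solver.solve-∀ ℚ-ring

𝟙[x²]⊛𝟙 : (𝟙 [x²]) ⊛ 𝟙 ≗ 𝟙
𝟙[x²]⊛𝟙 zero    = refl
𝟙[x²]⊛𝟙 (suc n) = cong (_+_ (1ℚ * 0ℚ)) (⊛-zeroˡ 𝟙 tail≡0 n)
  where
  tail≡0 : ∀ m → (𝟙 [x²]) (suc m) ≡ 0ℚ
  tail≡0 zero    = refl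
  tail≡0 (suc m) = [x²]-zero (λ _ → refl) m

∏[1-a²x²][x²]⊛∏⁻¹[1-ax]≗∏[1+ax] : ∀ a s →
  (∏[1+ (λ j → - (a j * a j)) x] s) [x²] ⊛ ∏⁻¹[1- a x] s ≗ ∏[1+ a x] s
∏[1-a²x²][x²]⊛∏⁻¹[1-ax]≗∏[1+ax] a zero      = 𝟙[x²]⊛𝟙
∏[1-a²x²][x²]⊛∏⁻¹[1-ax]≗∏[1+ax] a (suc s) n = begin
  (([1+ - (aₛ * aₛ) x]· E) [x²] ⊛ I /[1- aₛ x]) n
    ≡⟨ ⊛-cong ([x²]-[1+x]· aₛ E) (λ _ → refl) n ⟩
  ([1+ aₛ x]· ([1+ - aₛ x]· (E [x²])) ⊛ I /[1- aₛ x]) n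
    ≡⟨ [1+x]·-⊛ aₛ _ _ n ⟩
  ([1+ aₛ x]· ([1+ - aₛ x]· (E [x²]) ⊛ I /[1- aₛ x])) n
    ≡⟨ [1+x]·-cong aₛ ([1+x]·-⊛ (- aₛ) _ _) n ⟩
  ([1+ aₛ x]· ([1+ - aₛ x]· (E [x²] ⊛ I /[1- aₛ x]))) n
    ≡⟨ [1+x]·-cong aₛ (⊛-[1+x]· (- aₛ) _ _) n ⟨
  ([1+ aₛ x]· (E [x²] ⊛ [1+ - aₛ x]· (I /[1- aₛ x]))) n
    ≡⟨ [1+x]·-cong aₛ (⊛-cong (λ _ → refl) ([1-x]·-/[1-x] aₛ I)) n ⟩
  ([1+ aₛ x]· (E [x²] ⊛ I)) n
    ≡⟨ [1+x]·-cong aₛ (∏[1-a²x²][x²]⊛∏⁻¹[1-ax]≗∏[1+ax] a s) n ⟩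
  ([1+ aₛ x]· ∏[1+ a x] s) n
    ∎
  where
  open ≡-Reasoning
  aₛ = a s
  E = ∏[1+ (λ j → - (a j * a j)) x] s
  I = ∏⁻¹[1- a x] s

sumTo-suc : ∀ n f → sumTo (suc n) f ≡ f 0 + sumTo n (f ∘ suc)
sumTo-suc n f = cong (λ xs → f 0 + foldr _+_ 0ℚ xs)
  (trans (map-applyUpTo suc f n) (sym (map-applyUpTo id (f ∘ suc) n)))

sumTo-cong : ∀ n {f g} → f ≗ g → sumTo n f ≡ sumTo n g
sumTo-cong n f≗g = cong (foldr _+_ 0ℚ) (map-cong f≗g (upTo n))

sumTo-zero : ∀ n {f} → (∀ i → f i ≡ 0ℚ) → sumTo n f ≡ 0ℚ
sumTo-zero zero    f≡0 = refl
sumTo-zero (suc n) {f} f≡0 = trans (sumTo-suc n f) (cong₂ _+_ (f≡0 0) (sumTo-zero n (f≡0 ∘ suc)))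

private
  1<2[1+i] : ∀ i → 1 ℕ.< 2 ℕ.* suc i
  1<2[1+i] i = subst (1 ℕ.<_) (sym (ℕₚ.*-suc 2 i)) (ℕ.s<s ℕ.z<s)

  sumTo-head : ∀ N (f w : ℕ → ℚ) → (∀ i → w (suc i) ≡ 0ℚ) →
               sumTo (suc N) (λ i → f i * w i) ≡ f 0 * w 0
  sumTo-head N f w w∘suc≡0 = begin
    sumTo (suc N) (λ i → f i * w i)                  ≡⟨ sumTo-suc N (λ i → f i * w i) ⟩
    f 0 * w 0 + sumTo N (λ i → f (suc i) * w (suc i)) ≡⟨ cong (_+_ (f 0 * w 0)) (sumTo-zero N tail≡0) ⟩
    f 0 * w 0 + 0ℚ                                   ≡⟨ +-identityʳ (f 0 * w 0) ⟩
    f 0 * w 0                                        ∎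
    where
    open ≡-Reasoning
    tail≡0 : ∀ i → f (suc i) * w (suc i) ≡ 0ℚ
    tail≡0 i = trans (cong (f (suc i) *_) (w∘suc≡0 i)) (*-zeroʳ (f (suc i)))

-- w i plays the role of c (h - 2 i), which the hypotheses extend by 0 for 2 i > h.
[x²]⊛-coeff≡sumTo : ∀ f c w h N →
  (∀ i j → 2 ℕ.* i ℕ.+ j ≡ h → w i ≡ c j) → (∀ i → h ℕ.< 2 ℕ.* i → w i ≡ 0ℚ) → h ℕ.< 2 ℕ.* N →
  ((f [x²]) ⊛ c) h ≡ sumTo N (λ i → f i * w i)
[x²]⊛-coeff≡sumTo f c w h zero hit miss ()
[x²]⊛-coeff≡sumTo f c w zero (suc N) hit miss _ =
  trans (cong (f 0 *_) (sym (hit 0 0 refl)))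
        (sym (sumTo-head N f w (λ i → miss (suc i) (ℕₚ.<-trans ℕ.z<s (1<2[1+i] i)))))
[x²]⊛-coeff≡sumTo f c w (suc zero) (suc N) hit miss _ =
  trans (x+0*y≡x (f 0 * c 1) (c 0))
        (trans (cong (f 0 *_) (sym (hit 0 1 refl)))
               (sym (sumTo-head N f w (λ i → miss (suc i) (1<2[1+i] i)))))
  where
  x+0*y≡x : ∀ x y → x + 0ℚ * y ≡ x
  x+0*y≡x = Solver.solve-∀ ℚ-ring
[x²]⊛-coeff≡sumTo f c w (suc (suc h)) (suc N) hit miss h+2<2N+2 = begin
  f 0 * c (2 ℕ.+ h) + (0ℚ * c (suc h) + ((f ∘ suc) [x²] ⊛ c) h)
    ≡⟨ cong₂ (λ u v → f 0 * u + (0ℚ * c (suc h) + v)) (sym (hit 0 (2 ℕ.+ h) refl)) IH ⟩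
  f 0 * w 0 + (0ℚ * c (suc h) + sumTo N (λ i → f (suc i) * w (suc i)))
    ≡⟨ cong (_+_ (f 0 * w 0)) (0*y+x≡x (sumTo N (λ i → f (suc i) * w (suc i))) (c (suc h))) ⟩
  f 0 * w 0 + sumTo N (λ i → f (suc i) * w (suc i))
    ≡⟨ sumTo-suc N (λ i → f i * w i) ⟨
  sumTo (suc N) (λ i → f i * w i)
    ∎
  where
  open ≡-Reasoning
  IH : ((f ∘ suc) [x²] ⊛ c) h ≡ sumTo N (λ i → f (suc i) * w (suc i))
  IH = [x²]⊛-coeff≡sumTo (f ∘ suc) c (w ∘ suc) h N
    (λ i j 2i+j≡h → hit (suc i) j (trans (cong (ℕ._+ j) (ℕₚ.*-suc 2 i)) (cong (2 ℕ.+_) 2i+j≡h)))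
    (λ i h<2i → miss (suc i) (subst (suc (suc h) ℕ.<_) (sym (ℕₚ.*-suc 2 i)) (ℕ.s<s (ℕ.s<s h<2i))))
    (ℕ.s<s⁻¹ (ℕ.s<s⁻¹ (subst (suc (suc h) ℕ.<_) (ℕₚ.*-suc 2 N) h+2<2N+2)))
  0*y+x≡x : ∀ x y → 0ℚ * y + x ≡ x
  0*y+x≡x = Solver.solve-∀ ℚ-ring

-- Gaussian binomial coefficients

inv-inverseʳ : ∀ x → x ≢ 0ℚ → x * inv x ≡ 1ℚ
inv-inverseʳ x x≢0 with x ≟ 0ℚ
... | yes x≡0  = contradiction x≡0 x≢0
... | no  x≢0′ = *-inverseʳ x {{≢-nonZero x≢0′}}

qfac : ℚ → ℕ → ℚ
qfac r = poch r r

qfac-nonZero : ∀ {r} → NotRootOfUnity r → ∀ n → qfac r n ≢ 0ℚ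
qfac-nonZero r≉root zero = 1≢0
qfac-nonZero {r} r≉root (suc n) =
  x#0y#0→xy#0 (qfac-nonZero r≉root n) (r≉root n ∘ sym ∘ x∙y⁻¹≈ε⇒x≈y 1ℚ (r ^ suc n))

qbinom : ℚ → ℕ → ℕ → ℚ
qbinom r N K = if ⌊ K ≤? N ⌋ then qfac r N * inv (qfac r K * qfac r (N ∸ K)) else 0ℚ

n<k⇒qbinom≡0 : ∀ r {N K} → N ℕ.< K → qbinom r N K ≡ 0ℚ
n<k⇒qbinom≡0 r {N} {K} N<K with K ≤? N
... | yes K≤N = contradiction K≤N (ℕₚ.<⇒≱ N<K)
... | no  _   = refl

[1+n]C2≡nC2+n : ∀ n → suc n C 2 ≡ n C 2 ℕ.+ n
[1+n]C2≡nC2+n n = begin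
  suc n C 2        ≡⟨ nCk+nC[k+1]≡[n+1]C[k+1] n 1 ⟨
  n C 1 ℕ.+ n C 2  ≡⟨ cong (ℕ._+ n C 2) (nC1≡n n) ⟩
  n ℕ.+ n C 2      ≡⟨ ℕₚ.+-comm n (n C 2) ⟩
  n C 2 ℕ.+ n      ∎
  where open ≡-Reasoning

module _ {r : ℚ} (r≉root : NotRootOfUnity r) where

  private
    qbinom-formula : ∀ a b {N} → a ℕ.+ b ≡ N → qbinom r N a ≡ qfac r N * inv (qfac r a * qfac r b)
    qbinom-formula a b refl with a ≤? a ℕ.+ b
    ... | yes _   = cong (λ c → qfac r (a ℕ.+ b) * inv (qfac r a * qfac r c)) (ℕₚ.m+n∸m≡n a b)
    ... | no  a≰N = contradiction (ℕₚ.m≤m+n a b) a≰N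

    qfac*qfac≢0 : ∀ a b → qfac r a * qfac r b ≢ 0ℚ
    qfac*qfac≢0 a b = x#0y#0→xy#0 (qfac-nonZero r≉root a) (qfac-nonZero r≉root b)

  qbinom*qfac*qfac≡qfac : ∀ a b {N} → a ℕ.+ b ≡ N → qbinom r N a * (qfac r a * qfac r b) ≡ qfac r N
  qbinom*qfac*qfac≡qfac a b {N} a+b≡N = begin
    qbinom r N a * D         ≡⟨ cong (_* D) (qbinom-formula a b a+b≡N) ⟩
    (qfac r N * inv D) * D   ≡⟨ *-assoc (qfac r N) (inv D) D ⟩
    qfac r N * (inv D * D)   ≡⟨ cong (qfac r N *_) (trans (*-comm (inv D) D) (inv-inverseʳ D D≢0)) ⟩
    qfac r N * 1ℚ            ≡⟨ *-identityʳ (qfac r N) ⟩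
    qfac r N                 ∎
    where
    open ≡-Reasoning
    D = qfac r a * qfac r b
    D≢0 = qfac*qfac≢0 a b

  qbinom-unique : ∀ a b {N} x → a ℕ.+ b ≡ N → x * (qfac r a * qfac r b) ≡ qfac r N → qbinom r N a ≡ x
  qbinom-unique a b {N} x a+b≡N xD≡qfacN = begin
    qbinom r N a             ≡⟨ qbinom-formula a b a+b≡N ⟩
    qfac r N * inv D         ≡⟨ cong (_* inv D) xD≡qfacN ⟨
    (x * D) * inv D          ≡⟨ *-assoc x D (inv D) ⟩
    x * (D * inv D)          ≡⟨ cong (x *_) (inv-inverseʳ D D≢0) ⟩
    x * 1ℚ                   ≡⟨ *-identityʳ x ⟩
    x                        ∎
    where
    open ≡-Reasoning
    D = qfac r a * qfac r b
    D≢0 = qfac*qfac≢0 a b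

  qbinom[n,0]≡1 : ∀ N → qbinom r N 0 ≡ 1ℚ
  qbinom[n,0]≡1 N = qbinom-unique 0 N 1ℚ refl (trans (*-identityˡ _) (*-identityˡ (qfac r N)))

  qbinom[n,n]≡1 : ∀ N → qbinom r N N ≡ 1ℚ
  qbinom[n,n]≡1 N = qbinom-unique N 0 1ℚ (ℕₚ.+-identityʳ N) (trans (*-identityˡ _) (*-identityʳ (qfac r N)))

  private
    pascal-combine : ∀ G₁ G₂ D P x y → G₁ * D ≡ P * (1ℚ - x) → G₂ * D ≡ P * (1ℚ - y) →
                     (G₁ + x * G₂) * D ≡ P * (1ℚ - x * y)
    pascal-combine G₁ G₂ D P x y G₁D≡ G₂D≡ = begin
      (G₁ + x * G₂) * D                 ≡⟨ distrib G₁ G₂ D x ⟩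
      G₁ * D + x * (G₂ * D)             ≡⟨ cong₂ (λ u v → u + x * v) G₁D≡ G₂D≡ ⟩
      P * (1ℚ - x) + x * (P * (1ℚ - y)) ≡⟨ collect P x y ⟩
      P * (1ℚ - x * y)                  ∎
      where
      open ≡-Reasoning
      distrib : ∀ a b d x → (a + x * b) * d ≡ a * d + x * (b * d)
      distrib = Solver.solve-∀ ℚ-ring
      collect : ∀ P x y → P * (1ℚ - x) + x * (P * (1ℚ - y)) ≡ P * (1ℚ - x * y)
      collect = Solver.solve-∀ ℚ-ring

    -- Both Pascal rules for [a+b+2, a+1], obtained by clearing the q-factorials.
    module PascalStep (a b : ℕ) where
      N = suc (a ℕ.+ b)
      x = r ^ suc a
      y = r ^ suc b
      D = qfac r (suc a) * qfac r (suc b)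
      G₁ = qbinom r N a
      G₂ = qbinom r N (suc a)

      G₁D≡ : G₁ * D ≡ qfac r N * (1ℚ - x)
      G₁D≡ = trans (rearrange G₁ (qfac r a) (qfac r (suc b)) (1ℚ - x))
                   (cong (_* (1ℚ - x)) (qbinom*qfac*qfac≡qfac a (suc b) (ℕₚ.+-suc a b)))
        where
        rearrange : ∀ G A B u → G * ((A * u) * B) ≡ (G * (A * B)) * u
        rearrange = Solver.solve-∀ ℚ-ring

      G₂D≡ : G₂ * D ≡ qfac r N * (1ℚ - y)
      G₂D≡ = trans (rearrange G₂ (qfac r (suc a)) (qfac r b) (1ℚ - y))
                   (cong (_* (1ℚ - y)) (qbinom*qfac*qfac≡qfac (suc a) b refl))
        where
        rearrange : ∀ G A B u → G * (A * (B * u)) ≡ (G * (A * B)) * u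
        rearrange = Solver.solve-∀ ℚ-ring

      qfac[N+1]≡ : ∀ z → z ≡ x * y → qfac r N * (1ℚ - z) ≡ qfac r (suc N)
      qfac[N+1]≡ z refl = cong (λ e → qfac r N * (1ℚ - e))
        (trans (sym (^-homo-* r (suc a) (suc b))) (cong (λ n → r ^ suc n) (ℕₚ.+-suc a b)))

      a+b+2≡ : suc a ℕ.+ suc b ≡ suc N
      a+b+2≡ = cong suc (ℕₚ.+-suc a b)

      pascalˡ : qbinom r (suc N) (suc a) ≡ G₁ + x * G₂
      pascalˡ = qbinom-unique (suc a) (suc b) (G₁ + x * G₂) a+b+2≡
        (trans (pascal-combine G₁ G₂ D (qfac r N) x y G₁D≡ G₂D≡) (qfac[N+1]≡ (x * y) refl))

      pascalʳ : qbinom r (suc N) (suc a) ≡ G₂ + y * G₁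
      pascalʳ = qbinom-unique (suc a) (suc b) (G₂ + y * G₁) a+b+2≡
        (trans (pascal-combine G₂ G₁ D (qfac r N) y x G₂D≡ G₁D≡) (qfac[N+1]≡ (y * x) (*-comm y x)))

    x+y*0≡x : ∀ x y → x + y * 0ℚ ≡ x
    x+y*0≡x = Solver.solve-∀ ℚ-ring
    x*0+y≡y : ∀ x y → x * 0ℚ + y ≡ y
    x*0+y≡y = Solver.solve-∀ ℚ-ring
    x*0+y*0≡x*0 : ∀ x y → x * 0ℚ + y * 0ℚ ≡ x * 0ℚ
    x*0+y*0≡x*0 = Solver.solve-∀ ℚ-ring

    n<1+n+b : ∀ N b → N ℕ.< suc (N ℕ.+ b)
    n<1+n+b N b = ℕ.s≤s (ℕₚ.m≤m+n N b)

  qbinom-pascalˡ : ∀ N K → qbinom r (suc N) (suc K) ≡ qbinom r N K + r ^ suc K * qbinom r N (suc K)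
  qbinom-pascalˡ N K with compare K N
  ... | less .K b    = PascalStep.pascalˡ K b
  ... | equal .K     = trans (qbinom[n,n]≡1 (suc K)) (sym (trans
    (cong₂ (λ u v → u + r ^ suc K * v) (qbinom[n,n]≡1 K) (n<k⇒qbinom≡0 r (ℕₚ.n<1+n K)))
    (x+y*0≡x 1ℚ (r ^ suc K))))
  ... | greater .N b = trans (n<k⇒qbinom≡0 r (ℕ.s<s N<K)) (sym (trans
    (cong₂ (λ u v → u + r ^ suc K * v) (n<k⇒qbinom≡0 r N<K) (n<k⇒qbinom≡0 r (ℕₚ.m<n⇒m<1+n N<K)))
    (x+y*0≡x 0ℚ (r ^ suc K))))
    where
    N<K = n<1+n+b N b

  -- Scaled by r ^ K, the rule [N+1, K+1] = [N, K+1] + r^(N-K) [N, K] needs no truncated subtraction.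
  qbinom-pascalʳ : ∀ N K → r ^ K * qbinom r (suc N) (suc K) ≡ r ^ K * qbinom r N (suc K) + r ^ N * qbinom r N K
  qbinom-pascalʳ N K with compare K N
  ... | less .K b    = begin
    r ^ K * qbinom r (suc N) (suc K)      ≡⟨ cong (r ^ K *_) (PascalStep.pascalʳ K b) ⟩
    r ^ K * (G₂ + r ^ suc b * G₁)         ≡⟨ distrib (r ^ K) (r ^ suc b) G₂ G₁ ⟩
    r ^ K * G₂ + (r ^ K * r ^ suc b) * G₁ ≡⟨ cong (λ e → r ^ K * G₂ + e * G₁) rᴷrᵇ⁺¹≡rᴺ ⟩
    r ^ K * G₂ + r ^ N * G₁               ∎
    where
    open ≡-Reasoning
    G₁ = qbinom r N K
    G₂ = qbinom r N (suc K)
    rᴷrᵇ⁺¹≡rᴺ : r ^ K * r ^ suc b ≡ r ^ N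
    rᴷrᵇ⁺¹≡rᴺ = trans (sym (^-homo-* r K (suc b))) (cong (r ^_) (ℕₚ.+-suc K b))
    distrib : ∀ u v G₂ G₁ → u * (G₂ + v * G₁) ≡ u * G₂ + (u * v) * G₁
    distrib = Solver.solve-∀ ℚ-ring
  ... | equal .K     = trans (cong (r ^ K *_) (qbinom[n,n]≡1 (suc K))) (sym (trans
    (cong₂ (λ u v → r ^ K * u + r ^ K * v) (n<k⇒qbinom≡0 r (ℕₚ.n<1+n K)) (qbinom[n,n]≡1 K))
    (x*0+y≡y (r ^ K) (r ^ K * 1ℚ))))
  ... | greater .N b = trans (cong (r ^ K *_) (n<k⇒qbinom≡0 r (ℕ.s<s N<K))) (sym (trans
    (cong₂ (λ u v → r ^ K * u + r ^ N * v) (n<k⇒qbinom≡0 r (ℕₚ.m<n⇒m<1+n N<K)) (n<k⇒qbinom≡0 r N<K))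
    (x*0+y*0≡x*0 (r ^ K) (r ^ N))))
    where
    N<K = n<1+n+b N b

  q-binomial : ∀ c s n → (∏[1+ (λ j → c * r ^ j) x] s) n ≡ c ^ n * r ^ (n C 2) * qbinom r s n
  q-binomial c zero    zero    = sym (cong (1ℚ *_) (qbinom[n,0]≡1 0))
  q-binomial c zero    (suc n) = sym (trans
    (cong (c ^ suc n * r ^ (suc n C 2) *_) (n<k⇒qbinom≡0 r {0} {suc n} ℕ.z<s))
    (*-zeroʳ (c ^ suc n * r ^ (suc n C 2))))
  q-binomial c (suc s) zero    =
    trans (q-binomial c s 0) (cong (1ℚ *_) (trans (qbinom[n,0]≡1 s) (sym (qbinom[n,0]≡1 (suc s)))))
  q-binomial c (suc s) (suc n) = begin
    P (suc n) + (c * r ^ s) * P n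
      ≡⟨ cong₂ (λ u v → u + (c * r ^ s) * v) (q-binomial c s (suc n)) (q-binomial c s n) ⟩
    c ^ suc n * r ^ (suc n C 2) * G₂ + (c * r ^ s) * (c ^ n * r ^ (n C 2) * G₁)
      ≡⟨ cong (λ e → c ^ suc n * e * G₂ + (c * r ^ s) * (c ^ n * r ^ (n C 2) * G₁)) r^[1+n]C2 ⟩
    c * c ^ n * (r ^ (n C 2) * r ^ n) * G₂ + (c * r ^ s) * (c ^ n * r ^ (n C 2) * G₁)
      ≡⟨ factor c (c ^ n) (r ^ (n C 2)) (r ^ n) (r ^ s) G₁ G₂ ⟩
    c * c ^ n * r ^ (n C 2) * (r ^ n * G₂ + r ^ s * G₁)
      ≡⟨ cong (c * c ^ n * r ^ (n C 2) *_) (qbinom-pascalʳ s n) ⟨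
    c * c ^ n * r ^ (n C 2) * (r ^ n * qbinom r (suc s) (suc n))
      ≡⟨ unfactor c (c ^ n) (r ^ (n C 2)) (r ^ n) (qbinom r (suc s) (suc n)) ⟩
    c * c ^ n * (r ^ (n C 2) * r ^ n) * qbinom r (suc s) (suc n)
      ≡⟨ cong (λ e → c ^ suc n * e * qbinom r (suc s) (suc n)) r^[1+n]C2 ⟨
    c ^ suc n * r ^ (suc n C 2) * qbinom r (suc s) (suc n)
      ∎
    where
    open ≡-Reasoning
    P = ∏[1+ (λ j → c * r ^ j) x] s
    G₁ = qbinom r s n
    G₂ = qbinom r s (suc n)
    r^[1+n]C2 : r ^ (suc n C 2) ≡ r ^ (n C 2) * r ^ n
    r^[1+n]C2 = trans (cong (r ^_) ([1+n]C2≡nC2+n n)) (^-homo-* r (n C 2) n)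
    factor : ∀ c cⁿ X Y Z G₁ G₂ →
             c * cⁿ * (X * Y) * G₂ + (c * Z) * (cⁿ * X * G₁) ≡ c * cⁿ * X * (Y * G₂ + Z * G₁)
    factor = Solver.solve-∀ ℚ-ring
    unfactor : ∀ c cⁿ X Y G → c * cⁿ * X * (Y * G) ≡ c * cⁿ * (X * Y) * G
    unfactor = Solver.solve-∀ ℚ-ring

  negative-q-binomial : ∀ s n → (∏⁻¹[1- (r ^_) x] suc s) n ≡ qbinom r (n ℕ.+ s) s
  negative-q-binomial zero n = trans (∏⁻¹₁≡1 n) (sym (qbinom[n,0]≡1 (n ℕ.+ 0)))
    where
    ∏⁻¹₁≡1 : ∀ n → (∏⁻¹[1- (r ^_) x] 1) n ≡ 1ℚ
    ∏⁻¹₁≡1 zero    = refl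
    ∏⁻¹₁≡1 (suc n) = cong (_+_ 0ℚ) (trans (*-identityˡ _) (∏⁻¹₁≡1 n))
  negative-q-binomial (suc s) zero =
    trans (negative-q-binomial s 0) (trans (qbinom[n,n]≡1 s) (sym (qbinom[n,n]≡1 (suc s))))
  negative-q-binomial (suc s) (suc n) = begin
    (∏⁻¹[1- (r ^_) x] suc s) (suc n) + r ^ suc s * (∏⁻¹[1- (r ^_) x] (2 ℕ.+ s)) n
      ≡⟨ cong₂ (λ u v → u + r ^ suc s * v) (negative-q-binomial s (suc n)) (negative-q-binomial (suc s) n) ⟩
    qbinom r (suc n ℕ.+ s) s + r ^ suc s * qbinom r (n ℕ.+ suc s) (suc s)
      ≡⟨ cong (λ N → qbinom r N s + r ^ suc s * qbinom r (n ℕ.+ suc s) (suc s)) (ℕₚ.+-suc n s) ⟨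
    qbinom r (n ℕ.+ suc s) s + r ^ suc s * qbinom r (n ℕ.+ suc s) (suc s)
      ≡⟨ qbinom-pascalˡ (n ℕ.+ suc s) s ⟨
    qbinom r (suc n ℕ.+ suc s) (suc s)
      ∎
    where open ≡-Reasoning

-- Translation to the integer-indexed gbin

gbin-ℕ : ∀ k q N K → gbin k q (+ N) (+ K) ≡ qbinom (q ^ k) N K
gbin-ℕ k q N K with + 0 ℤₚ.≤? + K | + K ℤₚ.≤? + N | K ≤? N
... | yes _  | yes _    | yes _   = refl
... | yes _  | yes +K≤N | no K≰N  = contradiction (ℤₚ.drop‿+≤+ +K≤N) K≰N
... | yes _  | no +K≰N  | yes K≤N = contradiction (ℤ.+≤+ K≤N) +K≰N
... | yes _  | no _     | no _    = refl
... | no 0≰K | _        | _       = contradiction (ℤ.+≤+ ℕ.z≤n) 0≰K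

gbin-neg : ∀ k q {A B} → ¬ (B ℤ.≤ A) → gbin k q A B ≡ 0ℚ
gbin-neg k q {A} {B} B≰A with + 0 ℤₚ.≤? B | B ℤₚ.≤? A
... | yes _ | yes B≤A = contradiction B≤A B≰A
... | yes _ | no _    = refl
... | no _  | _       = refl

private
  shift : ∀ h d s → h ℤ.- d ℤ.+ (+ 1 ℤ.+ s) ℤ.- + 1 ≡ h ℤ.- d ℤ.+ s
  shift = ℤ-Solver.solve-∀

shifted-index≡ : ∀ {h d j} s′ → d ℕ.+ j ≡ h → + h ℤ.- + d ℤ.+ + suc s′ ℤ.- + 1 ≡ + (j ℕ.+ s′)
shifted-index≡ {d = d} {j} s′ refl = begin
  + (d ℕ.+ j) ℤ.- + d ℤ.+ + suc s′ ℤ.- + 1  ≡⟨ shift (+ (d ℕ.+ j)) (+ d) (+ s′) ⟩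
  + (d ℕ.+ j) ℤ.- + d ℤ.+ + s′              ≡⟨ cong (λ n → n ℤ.- + d ℤ.+ + s′) (ℤₚ.pos-+ d j) ⟩
  + d ℤ.+ + j ℤ.- + d ℤ.+ + s′              ≡⟨ cancel (+ d) (+ j) (+ s′) ⟩
  + j ℤ.+ + s′                              ∎
  where
  open ≡-Reasoning
  cancel : ∀ d j s → d ℤ.+ j ℤ.- d ℤ.+ s ≡ j ℤ.+ s
  cancel = ℤ-Solver.solve-∀

shifted-index-< : ∀ {h d} s′ → h ℕ.< d → ¬ (+ s′ ℤ.≤ + h ℤ.- + d ℤ.+ + suc s′ ℤ.- + 1)
shifted-index-< {h} {d} s′ h<d s′≤A =
  ℕₚ.<⇒≱ h<d (ℤₚ.drop‿+≤+ (ℤₚ.0≤i-j⇒j≤i (subst (ℤ.0ℤ ℤ.≤_) A-s′≡h-d (ℤₚ.i≤j⇒0≤j-i s′≤A))))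
  where
  cancel : ∀ h d s → h ℤ.- d ℤ.+ s ℤ.- s ≡ h ℤ.- d
  cancel = ℤ-Solver.solve-∀
  A-s′≡h-d : + h ℤ.- + d ℤ.+ + suc s′ ℤ.- + 1 ℤ.- + s′ ≡ + h ℤ.- + d
  A-s′≡h-d = trans (cong (ℤ._- + s′) (shift (+ h) (+ d) (+ s′))) (cancel (+ h) (+ d) (+ s′))

n*n≡2*nC2+n : ∀ n → n ℕ.* n ≡ 2 ℕ.* (n C 2) ℕ.+ n
n*n≡2*nC2+n zero    = refl
n*n≡2*nC2+n (suc n) = begin
  suc n ℕ.* suc n                        ≡⟨ expand n ⟩
  n ℕ.* n ℕ.+ 2 ℕ.* n ℕ.+ 1              ≡⟨ cong (λ m → m ℕ.+ 2 ℕ.* n ℕ.+ 1) (n*n≡2*nC2+n n) ⟩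
  2 ℕ.* (n C 2) ℕ.+ n ℕ.+ 2 ℕ.* n ℕ.+ 1  ≡⟨ regroup (n C 2) n ⟩
  2 ℕ.* (n C 2 ℕ.+ n) ℕ.+ suc n          ≡⟨ cong (λ m → 2 ℕ.* m ℕ.+ suc n) ([1+n]C2≡nC2+n n) ⟨
  2 ℕ.* (suc n C 2) ℕ.+ suc n            ∎
  where
  open ≡-Reasoning
  expand : ∀ n → suc n ℕ.* suc n ≡ n ℕ.* n ℕ.+ 2 ℕ.* n ℕ.+ 1
  expand = ℕ-Solver.solve-∀
  regroup : ∀ c n → 2 ℕ.* c ℕ.+ n ℕ.+ 2 ℕ.* n ℕ.+ 1 ≡ 2 ℕ.* (c ℕ.+ n) ℕ.+ suc n
  regroup = ℕ-Solver.solve-∀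

n*n∸n≡2*nC2 : ∀ n → n ℕ.* n ∸ n ≡ 2 ℕ.* (n C 2)
n*n∸n≡2*nC2 n = trans (cong (_∸ n) (n*n≡2*nC2+n n)) (ℕₚ.m+n∸n≡m (2 ℕ.* (n C 2)) n)

k*[n*n∸n]≡2k*nC2 : ∀ k n → k ℕ.* (n ℕ.* n ∸ n) ≡ 2 ℕ.* k ℕ.* (n C 2)
k*[n*n∸n]≡2k*nC2 k n = trans (cong (k ℕ.*_) (n*n∸n≡2*nC2 n)) (swap k (n C 2))
  where
  swap : ∀ k c → k ℕ.* (2 ℕ.* c) ≡ 2 ℕ.* k ℕ.* c
  swap = ℕ-Solver.solve-∀

k*[n*n∸n]/2≡k*nC2 : ∀ k n → (k ℕ.* (n ℕ.* n ∸ n)) / 2 ≡ k ℕ.* (n C 2)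
k*[n*n∸n]/2≡k*nC2 k n = begin
  (k ℕ.* (n ℕ.* n ∸ n)) / 2    ≡⟨ cong (_/ 2) (k*[n*n∸n]≡2k*nC2 k n) ⟩
  (2 ℕ.* k ℕ.* (n C 2)) / 2    ≡⟨ cong (_/ 2) (swap k (n C 2)) ⟩
  (k ℕ.* (n C 2) ℕ.* 2) / 2    ≡⟨ m*n/n≡m (k ℕ.* (n C 2)) 2 ⟩
  k ℕ.* (n C 2)                ∎
  where
  open ≡-Reasoning
  swap : ∀ k c → 2 ℕ.* k ℕ.* c ≡ k ℕ.* c ℕ.* 2
  swap = ℕ-Solver.solve-∀

alternating-gbin≡∏-coeff : ∀ k q → NotRootOfUnity (q ^ (2 ℕ.* k)) → ∀ s i →
  (- 1ℚ) ^ i * q ^ (k ℕ.* (i ℕ.* i ∸ i)) * gbin (2 ℕ.* k) q (+ s) (+ i)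
  ≡ (∏[1+ (λ j → - ((q ^ k) ^ j * (q ^ k) ^ j)) x] s) i
alternating-gbin≡∏-coeff k q q²ᵏ≉root s i = begin
  (- 1ℚ) ^ i * q ^ (k ℕ.* (i ℕ.* i ∸ i)) * gbin (2 ℕ.* k) q (+ s) (+ i)
    ≡⟨ cong₂ (λ u v → (- 1ℚ) ^ i * u * v) exponent (gbin-ℕ (2 ℕ.* k) q s i) ⟩
  (- 1ℚ) ^ i * (q ^ (2 ℕ.* k)) ^ (i C 2) * qbinom (q ^ (2 ℕ.* k)) s i
    ≡⟨ q-binomial q²ᵏ≉root (- 1ℚ) s i ⟨
  (∏[1+ (λ j → - 1ℚ * (q ^ (2 ℕ.* k)) ^ j) x] s) i
    ≡⟨ ∏-cong scalar s i ⟩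
  (∏[1+ (λ j → - ((q ^ k) ^ j * (q ^ k) ^ j)) x] s) i
    ∎
  where
  open ≡-Reasoning
  exponent : q ^ (k ℕ.* (i ℕ.* i ∸ i)) ≡ (q ^ (2 ℕ.* k)) ^ (i C 2)
  exponent = trans (cong (q ^_) (k*[n*n∸n]≡2k*nC2 k i)) (sym (^-assocʳ q (2 ℕ.* k) (i C 2)))
  q²ᵏ≡qᵏqᵏ : q ^ (2 ℕ.* k) ≡ q ^ k * q ^ k
  q²ᵏ≡qᵏqᵏ = trans (^-homo-* q k (k ℕ.+ 0)) (cong (λ m → q ^ k * q ^ m) (ℕₚ.+-identityʳ k))
  -1*x≡-x : ∀ x → - 1ℚ * x ≡ - x
  -1*x≡-x = Solver.solve-∀ ℚ-ring
  scalar : ∀ j → - 1ℚ * (q ^ (2 ℕ.* k)) ^ j ≡ - ((q ^ k) ^ j * (q ^ k) ^ j)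
  scalar j = trans (-1*x≡-x _) (cong -_ (trans (cong (_^ j) q²ᵏ≡qᵏqᵏ) (^-distrib-* (q ^ k) (q ^ k) j)))

∏-coeff≡scaled-gbin : ∀ k q → NotRootOfUnity (q ^ k) → ∀ s h →
  (∏[1+ ((q ^ k) ^_) x] s) h ≡ q ^ ((k ℕ.* (h ℕ.* h ∸ h)) / 2) * gbin k q (+ s) (+ h)
∏-coeff≡scaled-gbin k q qᵏ≉root s h = begin
  (∏[1+ (p ^_) x] s) h
    ≡⟨ ∏-cong (λ j → sym (*-identityˡ (p ^ j))) s h ⟩
  (∏[1+ (λ j → 1ℚ * p ^ j) x] s) h
    ≡⟨ q-binomial qᵏ≉root 1ℚ s h ⟩
  1ℚ ^ h * p ^ (h C 2) * qbinom p s h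
    ≡⟨ cong (λ u → u * p ^ (h C 2) * qbinom p s h) (1^n≡1 h) ⟩
  1ℚ * p ^ (h C 2) * qbinom p s h
    ≡⟨ cong₂ _*_ (trans (*-identityˡ (p ^ (h C 2))) (sym exponent)) (sym (gbin-ℕ k q s h)) ⟩
  q ^ ((k ℕ.* (h ℕ.* h ∸ h)) / 2) * gbin k q (+ s) (+ h)
    ∎
  where
  open ≡-Reasoning
  p = q ^ k
  exponent : q ^ ((k ℕ.* (h ℕ.* h ∸ h)) / 2) ≡ p ^ (h C 2)
  exponent = trans (cong (q ^_) (k*[n*n∸n]/2≡k*nC2 k h)) (sym (^-assocʳ q k (h C 2)))

shifted-gbin≡∏⁻¹-coeff : ∀ k q → NotRootOfUnity (q ^ k) → ∀ h s′ i j → 2 ℕ.* i ℕ.+ j ≡ h →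
  gbin k q (+ h ℤ.- + (2 ℕ.* i) ℤ.+ + suc s′ ℤ.- + 1) (+ suc s′ ℤ.- + 1)
  ≡ (∏⁻¹[1- ((q ^ k) ^_) x] suc s′) j
shifted-gbin≡∏⁻¹-coeff k q qᵏ≉root h s′ i j 2i+j≡h =
  trans (cong (λ A → gbin k q A (+ s′)) (shifted-index≡ s′ 2i+j≡h))
        (trans (gbin-ℕ k q (j ℕ.+ s′) s′) (sym (negative-q-binomial qᵏ≉root s′ j)))

corollary2p5 : (k h s : ℕ) → k ≥ 1 → s ≥ 1 → (q : ℚ) → q ≢ 1ℚ → q ≢ - 1ℚ →
    sumTo (ℕ.suc (h ℕ.+ s)) (λ i →
        ((- 1ℚ) ^ i) * (q ^ (k ℕ.* (i ℕ.* i ℕ.∸ i)))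
        * gbin (2 ℕ.* k) q (+ s) (+ i)
        * gbin k q (+ h ℤ.- + (2 ℕ.* i) ℤ.+ + s ℤ.- + 1) (+ s ℤ.- + 1))
    ≡ (q ^ ((k ℕ.* (h ℕ.* h ℕ.∸ h)) / 2)) * gbin k q (+ s) (+ h)
corollary2p5 k@(suc _) h s@(suc s′) _ _ q q≢1 q≢-1 = begin
  sumTo N (λ i → (- 1ℚ) ^ i * q ^ (k ℕ.* (i ℕ.* i ∸ i)) * gbin (2 ℕ.* k) q (+ s) (+ i) * w i)
    ≡⟨ sumTo-cong N (λ i → cong (_* w i) (alternating-gbin≡∏-coeff k q p²≉root s i)) ⟩
  sumTo N (λ i → E i * w i)
    ≡⟨ [x²]⊛-coeff≡sumTo E I w h N (shifted-gbin≡∏⁻¹-coeff k q p≉root h s′) miss h<2N ⟨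
  ((E [x²]) ⊛ I) h
    ≡⟨ ∏[1-a²x²][x²]⊛∏⁻¹[1-ax]≗∏[1+ax] (p ^_) s h ⟩
  (∏[1+ (p ^_) x] s) h
    ≡⟨ ∏-coeff≡scaled-gbin k q p≉root s h ⟩
  q ^ ((k ℕ.* (h ℕ.* h ∸ h)) / 2) * gbin k q (+ s) (+ h)
    ∎
  where
  open ≡-Reasoning
  N = suc (h ℕ.+ s)
  p = q ^ k
  p≉root = q^k≉root q≢1 q≢-1 k
  p²≉root = q^k≉root q≢1 q≢-1 (2 ℕ.* k)
  E = ∏[1+ (λ j → - (p ^ j * p ^ j)) x] s
  I = ∏⁻¹[1- (p ^_) x] s
  w : ℕ → ℚ
  w i = gbin k q (+ h ℤ.- + (2 ℕ.* i) ℤ.+ + s ℤ.- + 1) (+ s ℤ.- + 1)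
  miss : ∀ i → h ℕ.< 2 ℕ.* i → w i ≡ 0ℚ
  miss i h<2i = gbin-neg k q (shifted-index-< s′ h<2i)
  h<2N : h ℕ.< 2 ℕ.* N
  h<2N = ℕₚ.<-≤-trans (ℕ.s≤s (ℕₚ.m≤m+n h s)) (ℕₚ.m≤n*m N 2)
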